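{- No forest with no isolated vertices and with an odd number of connected components is factorizable.
   Context: All graphs are finite and simple. A graph $G$ on $n$ vertices is factorizable if there exist graphs $H$ and $K$ on $n$ vertices and adjacency matrices $A,B,C$ of $G,H,K$ respectively (symmetric $n\times n$ $(0,1)$-matrices with zero diagonal, for some vertex orderings) such that $A=BC$. -}

module Defs where

open import Data.Nat using (ℕ; zero; suc; _+_; _*_)
open import Data.Bool using (Bool; true; false)
open import Data.Fin using (Fin; zero; suc; inject₁; fromℕ)
open import Data.Fin.Permutation using (Permutation′; _⟨$⟩ʳ_)
open import Data.Product using (Σ; ∃; ∃-syntax; _×_)
open import Relation.Binary.PropositionalEquality using (_≡_)
open import Relation.Binary.Construct.Closure.ReflexiveTransitive using (Star)
open import Relation.Nullary using (¬_)
open import Function.Definitions using (Injective; Surjective)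
open import Function.Bundles using (_⇔_)

record Graph (n : ℕ) : Set where
  field
    adj   : Fin n → Fin n → Bool
    sym   : ∀ i j → adj i j ≡ adj j i
    irrefl : ∀ i → adj i i ≡ false
open Graph public

toℕ𝔹 : Bool → ℕ
toℕ𝔹 true  = 1
toℕ𝔹 false = 0

Σᶠ : (n : ℕ) → (Fin n → ℕ) → ℕ
Σᶠ zero    f = 0
Σᶠ (suc n) f = f zero + Σᶠ n (λ i → f (suc i))

-- adjacency matrix of G with respect to the vertex ordering σ (row/column i is vertex σ i)
adjMat : ∀ {n} → Graph n → Permutation′ n → Fin n → Fin n → ℕ
adjMat G σ i j = toℕ𝔹 (adj G (σ ⟨$⟩ʳ i) (σ ⟨$⟩ʳ j))

_⊗_ : ∀ {n} → (Fin n → Fin n → ℕ) → (Fin n → Fin n → ℕ) → Fin n → Fin n → ℕ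
_⊗_ {n} B C i j = Σᶠ n (λ k → B i k * C k j)

Factorizable : ∀ {n} → Graph n → Set
Factorizable {n} G =
  ∃[ H ] ∃[ K ] ∃[ σ ] ∃[ τ ] ∃[ ρ ]
    (∀ i j → adjMat G σ i j ≡ (adjMat {n} H τ ⊗ adjMat K ρ) i j)

Adj : ∀ {n} → Graph n → Fin n → Fin n → Set
Adj G u v = adj G u v ≡ true

Reachable : ∀ {n} → Graph n → Fin n → Fin n → Set
Reachable G = Star (Adj G)

-- a cycle of length k + 3: an injective closed walk v₀ … v_{k+2} v₀
HasCycle : ∀ {n} → Graph n → Set
HasCycle {n} G =
  Σ ℕ λ k → Σ (Fin (suc (suc (suc k))) → Fin n) λ c → (Injective _≡_ _≡_ c
    × (∀ (i : Fin (suc (suc k))) → Adj G (c (inject₁ i)) (c (suc i)))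
    × Adj G (c (fromℕ (suc (suc k)))) (c zero))

IsForest : ∀ {n} → Graph n → Set
IsForest G = ¬ HasCycle G

NoIsolatedVertices : ∀ {n} → Graph n → Set
NoIsolatedVertices G = ∀ v → ∃[ u ] Adj G v u

HasComponents : ∀ {n} → Graph n → ℕ → Set
HasComponents {n} G m =
  Σ (Fin n → Fin m) λ c → Surjective _≡_ _≡_ c × (∀ u v → (c u ≡ c v) ⇔ Reachable G u v)

{-# OPTIONS --safe #-}
-- Write A = B C for adjacency matrices of G, H and K in a common vertex order, and let
-- S = ∑ᵢⱼ Aᵢⱼ be the degree sum of G.
-- * G is a forest with m components, so S = 2 (n - m): delete a leaf or an isolated vertex.
-- * S = ∑ₖ degᴴ k · degᴷ k. Both degrees are positive since G has no isolated vertex, and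
--   not both are ≥ 2 since G has no 4-cycle; so degᴴ k · degᴷ k + 1 = degᴴ k + degᴷ k, and
--   S + n = ∑ degᴴ + ∑ degᴷ is even.
-- * S = ∑ᵢⱼ Aᵢⱼ Aⱼᵢ counts the closed walks i –H– k –K– j –H– l –K– i. Their four vertices
--   are distinct, and the double transpositions of (i, j, k, l) act freely on them, so 4 ∣ S.
-- Hence n is even, then n - m is even, and so m is even.
module Submission where

open import Defs
open import Data.Nat using (ℕ; zero; suc; _+_; _*_; _≤_; _<_; _≤?_; z≤n; s≤s; s≤s⁻¹; _%_)
open import Data.Nat.Properties
  using ( +-*-semiring; module ≤-Reasoning; ≤-trans; ≤-reflexive; ≰⇒>; m≤m+n; n<1+n; +-monoˡ-<
        ; m≤n⇒∃[o]m+o≡n; 0≢1+n; +-comm; +-identityʳ; *-comm; *-identityʳ; *-zeroʳ; *-suc )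
open import Data.Nat.Induction using (<-rec)
open import Data.Nat.Divisibility
  using (_∣_; divides; m∣m*n; ∣m∣n⇒∣m+n; ∣m+n∣m⇒∣n; ∣-trans; *-monoʳ-∣; *-cancelˡ-∣; n∣m⇒m%n≡0)
open import Data.Nat.Tactic.RingSolver using (solve-∀)
open import Data.Bool using (Bool; true; false)
open import Data.Fin as Fin using (Fin; zero; suc; toℕ; fromℕ; fromℕ<; inject₁; punchIn; punchOut)
open import Data.Fin.Properties
  using ( _≟_; _<?_; <-cmp; <-trans; <-asym; any?; pigeonhole; toℕ<n; toℕ-fromℕ<; toℕ-fromℕ
        ; toℕ-inject₁; punchIn-punchOut; punchInᵢ≢i; punchIn-injective; punchOut-cong
        ; punchOut-injective; punchOut-punchIn )
open import Data.Fin.Permutation using (Permutation′; _⟨$⟩ʳ_; _⟨$⟩ˡ_; inverseʳ)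
open import Data.Vec using (Vec; []; _∷_; lookup)
open import Data.Vec.Relation.Unary.All using ([]; _∷_)
open import Data.Vec.Relation.Unary.AllPairs using ([]; _∷_)
open import Data.Vec.Relation.Unary.Unique.Propositional using (Unique)
open import Data.Vec.Relation.Unary.Unique.Propositional.Properties using (lookup-injective)
open import Data.Product using (∃; ∃₂; _×_; _,_; proj₁; proj₂)
open import Data.Sum using (_⊎_; inj₁; inj₂)
open import Data.Empty using (⊥; ⊥-elim)
open import Function using (_∘_)
open import Function.Definitions using (Injective)
open import Function.Bundles using (_⇔_; mk⇔; Equivalence; Injection)
open import Function.Properties.Inverse using (↔⇒↣)
open import Function.Consequences.Propositional
  using (strictlySurjective⇒surjective; surjective⇒strictlySurjective)
open import Relation.Binary.PropositionalEquality as ≡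
  using (_≡_; _≢_; refl; trans; cong; cong₂; subst; subst₂; ≢-sym)
open import Relation.Binary.Construct.Closure.ReflexiveTransitive using (Star; ε; _◅_; gmap)
open import Relation.Binary.Definitions using (tri<; tri≈; tri>)
open import Relation.Nullary using (¬_; yes; no; does)
open import Relation.Nullary.Decidable using (dec-true; dec-false)
open import Relation.Unary using (Decidable)
open import Algebra.Properties.Semiring.Sum +-*-semiring
  using (sum; sum-syntax; sum-cong-≗; sum-remove; ∑-comm; ∑-distrib-+; ∑-permute; *-distribˡ-sum; *-distribʳ-sum)

open Equivalence using (to; from)

Σᶠ≡sum : ∀ n (f : Fin n → ℕ) → Σᶠ n f ≡ sum f
Σᶠ≡sum zero    f = refl
Σᶠ≡sum (suc n) f = cong (f zero +_) (Σᶠ≡sum n (f ∘ suc))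

sum-replicate-1 : ∀ n → ∑[ i < n ] 1 ≡ n
sum-replicate-1 zero    = refl
sum-replicate-1 (suc n) = cong suc (sum-replicate-1 n)

xᵢ≤sum : ∀ {n} (f : Fin n → ℕ) i → f i ≤ sum f
xᵢ≤sum {suc n} f i = ≤-trans (m≤m+n (f i) _) (≤-reflexive (≡.sym (sum-remove f)))

∃-positive-term : ∀ {n} (f : Fin n → ℕ) → 1 ≤ sum f → ∃ λ i → 1 ≤ f i
∃-positive-term {suc n} f h with f zero in eq
... | suc _ = zero , subst (1 ≤_) (≡.sym eq) (s≤s z≤n)
... | zero  = let i , fᵢ = ∃-positive-term (f ∘ suc) h in suc i , fᵢ

toℕ𝔹-positive : ∀ {b} → 1 ≤ toℕ𝔹 b → b ≡ true
toℕ𝔹-positive {true} _ = refl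

toℕ𝔹*toℕ𝔹-positive : ∀ {a b} → 1 ≤ toℕ𝔹 a * toℕ𝔹 b → a ≡ true × b ≡ true
toℕ𝔹*toℕ𝔹-positive {true} {true} _ = refl , refl

toℕ𝔹⁴-positive : ∀ {a b c d} → 1 ≤ (toℕ𝔹 a * toℕ𝔹 b) * (toℕ𝔹 c * toℕ𝔹 d) →
                 a ≡ true × b ≡ true × c ≡ true × d ≡ true
toℕ𝔹⁴-positive {true}  {true}  {true}  {true}  _ = refl , refl , refl , refl
toℕ𝔹⁴-positive {false} ()
toℕ𝔹⁴-positive {true}  {false} ()
toℕ𝔹⁴-positive {true}  {true}  {false} ()
toℕ𝔹⁴-positive {true}  {true}  {true}  {false} ()

toℕ𝔹-idem : ∀ b → toℕ𝔹 b ≡ toℕ𝔹 b * toℕ𝔹 b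
toℕ𝔹-idem true  = refl
toℕ𝔹-idem false = refl

count : ∀ {n} → (Fin n → Bool) → ℕ
count b = sum (toℕ𝔹 ∘ b)

count-true : ∀ {n} (b : Fin n → Bool) {i} → b i ≡ true → 1 ≤ count b
count-true b {i} bᵢ = ≤-trans (≤-reflexive (cong toℕ𝔹 (≡.sym bᵢ))) (xᵢ≤sum (toℕ𝔹 ∘ b) i)

count-positive : ∀ {n} (b : Fin n → Bool) → 1 ≤ count b → ∃ λ i → b i ≡ true
count-positive b h = let i , bᵢ = ∃-positive-term (toℕ𝔹 ∘ b) h in i , toℕ𝔹-positive bᵢ

count-remove : ∀ {n} (b : Fin (suc n) → Bool) {i} → b i ≡ true → count b ≡ suc (count (b ∘ punchIn i))
count-remove b {i} bᵢ = trans (sum-remove (toℕ𝔹 ∘ b)) (cong (λ x → toℕ𝔹 x + count (b ∘ punchIn i)) bᵢ)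

count-two : ∀ {n} (b : Fin n → Bool) {i j} → i ≢ j → b i ≡ true → b j ≡ true → 2 ≤ count b
count-two {suc n} b {i} {j} i≢j bᵢ bⱼ =
  ≤-trans (s≤s (count-true (b ∘ punchIn i) (trans (cong b (punchIn-punchOut i≢j)) bⱼ)))
          (≤-reflexive (≡.sym (count-remove b bᵢ)))

count≤1⇒unique : ∀ {n} (b : Fin n → Bool) → count b ≤ 1 →
                 ∀ {i j} → b i ≡ true → b j ≡ true → i ≡ j
count≤1⇒unique {suc n} b h {i} {j} bᵢ bⱼ with i ≟ j
... | yes i≡j = i≡j
... | no  i≢j with s≤s () ← ≤-trans (count-two b i≢j bᵢ bⱼ) h

2≤count⇒two : ∀ {n} (b : Fin n → Bool) → 2 ≤ count b →
              ∃₂ λ i j → i ≢ j × b i ≡ true × b j ≡ true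
2≤count⇒two {suc n} b h =
  let i , bᵢ = count-positive b (≤-trans (s≤s z≤n) h)
      j , bⱼ = count-positive (b ∘ punchIn i) (s≤s⁻¹ (≤-trans h (≤-reflexive (count-remove b bᵢ))))
  in i , punchIn i j , (λ e → punchInᵢ≢i i j (≡.sym e)) , bᵢ , bⱼ

-- Cycles and leaves

adjℕ : ∀ {n} → Graph n → Fin n → Fin n → ℕ
adjℕ G i j = toℕ𝔹 (adj G i j)

degree : ∀ {n} → Graph n → Fin n → ℕ
degree G v = count (adj G v)

Isolated : ∀ {n} → Graph n → Fin n → Set
Isolated G v = ∀ {a} → ¬ Adj G v a

AtMostOneNeighbour : ∀ {n} → Graph n → Fin n → Set
AtMostOneNeighbour G v = ∀ {a b} → Adj G v a → Adj G v b → a ≡ b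

Adj-sym : ∀ {n} (G : Graph n) {u v} → Adj G u v → Adj G v u
Adj-sym G {u} {v} = trans (sym G v u)

Adj⇒≢ : ∀ {n} (G : Graph n) {u v} → Adj G u v → u ≢ v
Adj⇒≢ G {u} e refl with () ← trans (≡.sym (irrefl G u)) e

square⇒cycle : ∀ {n} (G : Graph n) {a b c d} →
               Adj G a b → Adj G b c → Adj G c d → Adj G d a → a ≢ c → b ≢ d → HasCycle G
square⇒cycle G {a} {b} {c} {d} ab bc cd da a≢c b≢d =
  1 , lookup cycle , (λ {i} {j} → lookup-injective distinct i j) , edges , da
  where
  cycle : Vec (Fin _) 4
  cycle = a ∷ b ∷ c ∷ d ∷ []
  distinct : Unique cycle
  distinct = (Adj⇒≢ G ab ∷ a≢c ∷ ≢-sym (Adj⇒≢ G da) ∷ [])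
           ∷ (Adj⇒≢ G bc ∷ b≢d ∷ [])
           ∷ (Adj⇒≢ G cd ∷ [])
           ∷ [] ∷ []
  edges : ∀ (i : Fin 3) → Adj G (lookup cycle (inject₁ i)) (lookup cycle (suc i))
  edges zero             = ab
  edges (suc zero)       = bc
  edges (suc (suc zero)) = cd

least-witness : ∀ {p} {P : ℕ → Set p} → Decidable P →
                ∀ b → P b → ∃ λ a → P a × (∀ c → c < a → ¬ P c)
least-witness {P = P} P? = <-rec _ search
  where
  search : ∀ b → (∀ {c} → c < b → P c → ∃ λ a → P a × (∀ c → c < a → ¬ P c)) →
           P b → ∃ λ a → P a × (∀ c → c < a → ¬ P c)
  search b smaller Pb with any? (λ (c : Fin b) → P? (toℕ c))
  ... | yes (c , Pc) = smaller (toℕ<n c) Pc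
  ... | no ¬P<b      = b , Pb , λ c c<b Pc →
                         ¬P<b (fromℕ< c<b , subst P (≡.sym (toℕ-fromℕ< c<b)) Pc)

-- The first vertex the walk revisits closes a cycle, which has length at least three
-- because G is loopless and the walk never backtracks.
nonBacktracking⇒cycle : ∀ {n} (G : Graph n) (w : ℕ → Fin n) →
                        (∀ t → Adj G (w t) (w (suc t))) → (∀ t → w (suc (suc t)) ≢ w t) →
                        HasCycle G
nonBacktracking⇒cycle {n} G w walk backtrack-free =
  from-first-revisit (least-witness revisits? _ (proj₂ some-revisit))
  where
  Revisits : ℕ → Set
  Revisits b = ∃ λ (a : Fin b) → w (toℕ a) ≡ w b
  revisits? : Decidable Revisits
  revisits? b = any? (λ a → w (toℕ a) ≟ w b)
  some-revisit : ∃ Revisits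
  some-revisit =
    let i , j , i<j , wᵢ≡wⱼ = pigeonhole (n<1+n n) (w ∘ toℕ)
    in toℕ j , fromℕ< i<j , trans (cong w (toℕ-fromℕ< i<j)) wᵢ≡wⱼ
  revisit⇒cycle : ∀ a o → (∀ s t → s < t → t < suc o + a → w s ≢ w t) →
                  w a ≡ w (suc o + a) → HasCycle G
  revisit⇒cycle a zero                _        loop = ⊥-elim (Adj⇒≢ G (walk a) loop)
  revisit⇒cycle a (suc zero)          _        loop = ⊥-elim (backtrack-free a (≡.sym loop))
  revisit⇒cycle a (suc (suc k))       distinct loop = k , c , c-inj , edges , closing
    where
    c : Fin (3 + k) → Fin n
    c t = w (toℕ t + a)
    c-inj : Injective _≡_ _≡_ c
    c-inj {s} {t} cₛ≡cₜ with <-cmp s t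
    ... | tri< s<t _ _ = ⊥-elim (distinct _ _ (+-monoˡ-< a s<t) (+-monoˡ-< a (toℕ<n t)) cₛ≡cₜ)
    ... | tri≈ _ s≡t _ = s≡t
    ... | tri> _ _ t<s = ⊥-elim (distinct _ _ (+-monoˡ-< a t<s) (+-monoˡ-< a (toℕ<n s)) (≡.sym cₛ≡cₜ))
    edges : ∀ (i : Fin (2 + k)) → Adj G (c (inject₁ i)) (c (suc i))
    edges i = subst (λ x → Adj G (w (x + a)) (w (suc (toℕ i + a)))) (≡.sym (toℕ-inject₁ i)) (walk (toℕ i + a))
    closing : Adj G (c (fromℕ (2 + k))) (c zero)
    closing = subst₂ (λ x y → Adj G (w (x + a)) y) (≡.sym (toℕ-fromℕ (2 + k))) (≡.sym loop) (walk (2 + k + a))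
  from-first-revisit : (∃ λ b → Revisits b × (∀ c → c < b → ¬ Revisits c)) → HasCycle G
  from-first-revisit (b , (a , wₐ≡w_b) , first) =
    revisit⇒cycle (toℕ a) o
      (λ s t s<t t<b wₛ≡wₜ →
         first t (subst (t <_) b≡ t<b) (fromℕ< s<t , trans (cong w (toℕ-fromℕ< s<t)) wₛ≡wₜ))
      (trans wₐ≡w_b (cong w (≡.sym b≡)))
    where
    o : ℕ
    o = proj₁ (m≤n⇒∃[o]m+o≡n (toℕ<n a))
    b≡ : suc o + toℕ a ≡ b
    b≡ = trans (cong suc (+-comm o (toℕ a))) (proj₂ (m≤n⇒∃[o]m+o≡n (toℕ<n a)))

minDegree2⇒cycle : ∀ {n} (G : Graph (suc n)) → (∀ v → 2 ≤ degree G v) → HasCycle G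
minDegree2⇒cycle G 2≤degree = nonBacktracking⇒cycle G w walk backtrack-free
  where
  onward : ∀ v x → ∃ λ y → Adj G v y × y ≢ x
  onward v x with i , j , i≢j , vi , vj ← 2≤count⇒two (adj G v) (2≤degree v) | i ≟ x
  ... | no  i≢x  = i , vi , i≢x
  ... | yes refl = j , vj , ≢-sym i≢j
  -- steps t = (w t , w (suc t))
  steps : ℕ → Fin _ × Fin _
  steps zero    = zero , proj₁ (onward zero zero)
  steps (suc t) = let (x , v) = steps t in v , proj₁ (onward v x)
  w : ℕ → Fin _
  w = proj₁ ∘ steps
  walk : ∀ t → Adj G (w t) (w (suc t))
  walk zero    = proj₁ (proj₂ (onward zero zero))
  walk (suc t) = proj₁ (proj₂ (onward (w (suc t)) (w t)))
  backtrack-free : ∀ t → w (suc (suc t)) ≢ w t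
  backtrack-free t = proj₂ (proj₂ (onward (w (suc t)) (w t)))

forest⇒leaf : ∀ {n} (G : Graph (suc n)) → IsForest G → ∃ λ v → degree G v ≤ 1
forest⇒leaf G forest with any? (λ v → degree G v ≤? 1)
... | yes leaf    = leaf
... | no  no-leaf = ⊥-elim (forest (minDegree2⇒cycle G (λ v → ≰⇒> (no-leaf ∘ (v ,_)))))

degree≡0⇒isolated : ∀ {n} (G : Graph n) {v} → degree G v ≡ 0 → Isolated G v
degree≡0⇒isolated G deg-v va with () ← subst (1 ≤_) deg-v (count-true (adj G _) va)

degree≡1⇒leaf : ∀ {n} (G : Graph n) {v} → degree G v ≡ 1 →
                ∃ λ p → Adj G v p × AtMostOneNeighbour G v
degree≡1⇒leaf G {v} deg-v =
  let p , vp = count-positive (adj G v) (≤-reflexive (≡.sym deg-v))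
  in p , vp , count≤1⇒unique (adj G v) (≤-reflexive deg-v)

-- Relabelling, vertex deletion and the degree sum of a forest

pullback : ∀ {m n} → (Fin n → Fin m) → Graph m → Graph n
pullback f G = record
  { adj    = λ i j → adj G (f i) (f j)
  ; sym    = λ i j → sym G (f i) (f j)
  ; irrefl = λ i → irrefl G (f i)
  }

pullback-forest : ∀ {m n} (f : Fin n → Fin m) (G : Graph m) →
                  Injective _≡_ _≡_ f → IsForest G → IsForest (pullback f G)
pullback-forest f G f-inj forest (k , c , c-inj , edges , closing) =
  forest (k , f ∘ c , c-inj ∘ f-inj , edges , closing)

pullback-reachable : ∀ {m n} {f : Fin n → Fin m} {G : Graph m} {i j} →
                     Reachable (pullback f G) i j → Reachable G (f i) (f j)
pullback-reachable {f = f} = gmap f (λ e → e)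

∑-degree-permute : ∀ {n} (G : Graph n) (σ : Permutation′ n) →
                   ∑[ v < n ] degree (pullback (σ ⟨$⟩ʳ_) G) v ≡ ∑[ v < n ] degree G v
∑-degree-permute G σ =
  trans (sum-cong-≗ (λ v → ≡.sym (∑-permute (adjℕ G (σ ⟨$⟩ʳ v)) σ)))
        (≡.sym (∑-permute (degree G) σ))

permute-noIsolatedVertices : ∀ {n} (G : Graph n) (σ : Permutation′ n) →
                             NoIsolatedVertices G → NoIsolatedVertices (pullback (σ ⟨$⟩ʳ_) G)
permute-noIsolatedVertices G σ noIsolated v =
  let u , vu = noIsolated (σ ⟨$⟩ʳ v)
  in σ ⟨$⟩ˡ u , subst (Adj G (σ ⟨$⟩ʳ v)) (≡.sym (inverseʳ σ)) vu

_∖_ : ∀ {n} → Graph (suc n) → Fin (suc n) → Graph n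
G ∖ v = pullback (punchIn v) G

∖-forest : ∀ {n} (G : Graph (suc n)) v → IsForest G → IsForest (G ∖ v)
∖-forest G v = pullback-forest (punchIn v) G (punchIn-injective v _ _)

∑-degree-∖ : ∀ {n} (G : Graph (suc n)) v →
             ∑[ u < suc n ] degree G u ≡ 2 * degree G v + ∑[ u < n ] degree (G ∖ v) u
∑-degree-∖ {n} G v = begin
  ∑[ u < suc n ] degree G u
    ≡⟨ sum-remove (degree G) ⟩
  degree G v + ∑[ i < n ] degree G (punchIn v i)
    ≡⟨ cong (degree G v +_) (sum-cong-≗ (λ i → sum-remove (adjℕ G (punchIn v i)))) ⟩
  degree G v + ∑[ i < n ] (adjℕ G (punchIn v i) v + degree (G ∖ v) i)
    ≡⟨ cong (degree G v +_) (∑-distrib-+ (λ i → adjℕ G (punchIn v i) v) (degree (G ∖ v))) ⟩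
  degree G v + (∑[ i < n ] adjℕ G (punchIn v i) v + ∑[ i < n ] degree (G ∖ v) i)
    ≡⟨ cong (λ d → degree G v + (d + ∑[ i < n ] degree (G ∖ v) i)) column ⟩
  degree G v + (degree G v + ∑[ i < n ] degree (G ∖ v) i)
    ≡⟨ x+[x+y]≡2x+y (degree G v) _ ⟩
  2 * degree G v + ∑[ u < n ] degree (G ∖ v) u ∎
  where
  open ≡.≡-Reasoning
  x+[x+y]≡2x+y : ∀ x y → x + (x + y) ≡ 2 * x + y
  x+[x+y]≡2x+y = solve-∀
  column : ∑[ i < n ] adjℕ G (punchIn v i) v ≡ degree G v
  column = begin
    ∑[ i < n ] adjℕ G (punchIn v i) v   ≡⟨ sum-cong-≗ (λ i → cong toℕ𝔹 (sym G (punchIn v i) v)) ⟩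
    ∑[ i < n ] adjℕ G v (punchIn v i)   ≡⟨ cong (λ b → toℕ𝔹 b + ∑[ i < n ] adjℕ G v (punchIn v i)) (irrefl G v) ⟨
    adjℕ G v v + ∑[ i < n ] adjℕ G v (punchIn v i) ≡⟨ sum-remove (adjℕ G v) ⟨
    degree G v                          ∎

2∣∑-degree : ∀ {n} (G : Graph n) → 2 ∣ ∑[ v < n ] degree G v
2∣∑-degree {zero}  G = divides 0 refl
2∣∑-degree {suc n} G = subst (2 ∣_) (≡.sym (∑-degree-∖ G zero))
  (∣m∣n⇒∣m+n (m∣m*n (degree G zero)) (2∣∑-degree (G ∖ zero)))

∖-reachable : ∀ {n} (G : Graph (suc n)) v → AtMostOneNeighbour G v →
              ∀ {i j} → Reachable G (punchIn v i) (punchIn v j) → Reachable (G ∖ v) i j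
∖-reachable G v unique = avoiding refl refl
  where
  avoiding : ∀ {x y i j} → x ≡ punchIn v i → y ≡ punchIn v j →
             Star (Adj G) x y → Reachable (G ∖ v) i j
  avoiding {i = i} x≡vᵢ y≡vⱼ ε =
    subst (Reachable (G ∖ v) i) (punchIn-injective v _ _ (trans (≡.sym x≡vᵢ) y≡vⱼ)) ε
  avoiding x≡vᵢ y≡vⱼ (_◅_ {j = z} x~z z⇝y) with v ≟ z
  ... | no v≢z =
    subst₂ (Adj G) x≡vᵢ (≡.sym (punchIn-punchOut v≢z)) x~z
      ◅ avoiding (≡.sym (punchIn-punchOut v≢z)) y≡vⱼ z⇝y
  ... | yes refl with z⇝y  -- the walk goes x → v → x, as v has no other neighbour
  ...   | ε             = ⊥-elim (punchInᵢ≢i v _ (≡.sym y≡vⱼ))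
  ...   | v~w ◅ w⇝y     = avoiding (trans (unique v~w (Adj-sym G x~z)) x≡vᵢ) y≡vⱼ w⇝y

∖-leaf-components : ∀ {n m} (G : Graph (suc n)) {v p} → Adj G v p →
                    AtMostOneNeighbour G v →
                    HasComponents G m → HasComponents (G ∖ v) m
∖-leaf-components G {v} {p} vp unique (c , c-surj , c≡⇔reachable) =
  c ∘ punchIn v ,
  strictlySurjective⇒surjective c′-surj ,
  λ i j → mk⇔ (∖-reachable G v unique ∘ to (c≡⇔reachable _ _))
              (from (c≡⇔reachable _ _) ∘ pullback-reachable {G = G})
  where
  c′-surj : ∀ y → ∃ λ i → c (punchIn v i) ≡ y
  c′-surj y with u , cu≡y ← surjective⇒strictlySurjective c-surj y | v ≟ u
  ... | no v≢u   = punchOut v≢u , trans (cong c (punchIn-punchOut v≢u)) cu≡y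
  ... | yes refl = punchOut (Adj⇒≢ G vp) ,
                   trans (cong c (punchIn-punchOut (Adj⇒≢ G vp)))
                         (trans (from (c≡⇔reachable p v) (Adj-sym G vp ◅ ε)) cu≡y)

∖-isolated-components : ∀ {n m} (G : Graph (suc n)) {v} → Isolated G v →
                        HasComponents G (suc m) → HasComponents (G ∖ v) m
∖-isolated-components G {v} isolated (c , c-surj , c≡⇔reachable) =
  c′ , strictlySurjective⇒surjective c′-surj , c′≡⇔reachable
  where
  alone : ∀ {u} → c v ≡ c u → v ≡ u
  alone cv≡cu with to (c≡⇔reachable _ _) cv≡cu
  ... | ε        = refl
  ... | v~w ◅ _ = ⊥-elim (isolated v~w)
  c-separates : ∀ i → c v ≢ c (punchIn v i)
  c-separates i = punchInᵢ≢i v i ∘ ≡.sym ∘ alone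
  c′ : Fin _ → Fin _
  c′ i = punchOut (c-separates i)
  c′≡⇔reachable : ∀ i j → (c′ i ≡ c′ j) ⇔ Reachable (G ∖ v) i j
  c′≡⇔reachable i j =
    mk⇔ (∖-reachable G v (λ va → ⊥-elim (isolated va)) ∘ to (c≡⇔reachable _ _)
           ∘ punchOut-injective (c-separates i) (c-separates j))
        (punchOut-cong (c v) ∘ from (c≡⇔reachable _ _) ∘ pullback-reachable {G = G})
  c′-surj : ∀ y → ∃ λ i → c′ i ≡ y
  c′-surj y =
    let u , cu≡y = surjective⇒strictlySurjective c-surj (punchIn (c v) y)
        v≢u : v ≢ u
        v≢u v≡u = punchInᵢ≢i (c v) y (≡.sym (trans (cong c v≡u) cu≡y))
    in punchOut v≢u ,
       trans (punchOut-cong (c v) (trans (cong c (punchIn-punchOut v≢u)) cu≡y))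
             (punchOut-punchIn (c v))

∑-degree-∖-step : ∀ {n} (G : Graph (suc n)) v {m m′} → degree G v + m ≡ suc m′ →
                    ∑[ u < n ] degree (G ∖ v) u + 2 * m′ ≡ 2 * n →
                    ∑[ u < suc n ] degree G u + 2 * m ≡ 2 * suc n
∑-degree-∖-step {n} G v {m} {m′} d+m≡1+m′ ih = begin
  ∑[ u < suc n ] degree G u + 2 * m       ≡⟨ cong (_+ 2 * m) (∑-degree-∖ G v) ⟩
  2 * degree G v + ∑G∖v + 2 * m          ≡⟨ regroup (degree G v) ∑G∖v m ⟩
  ∑G∖v + 2 * (degree G v + m)            ≡⟨ cong (λ x → ∑G∖v + 2 * x) d+m≡1+m′ ⟩
  ∑G∖v + 2 * suc m′                      ≡⟨ shift ∑G∖v m′ ⟩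
  2 + (∑G∖v + 2 * m′)                    ≡⟨ cong (2 +_) ih ⟩
  2 + 2 * n                              ≡⟨ *-suc 2 n ⟨
  2 * suc n                              ∎
  where
  open ≡.≡-Reasoning
  ∑G∖v : ℕ
  ∑G∖v = ∑[ u < n ] degree (G ∖ v) u
  regroup : ∀ d s m → 2 * d + s + 2 * m ≡ s + 2 * (d + m)
  regroup = solve-∀
  shift : ∀ s m → s + 2 * suc m ≡ 2 + (s + 2 * m)
  shift = solve-∀

forest-∑-degree : ∀ {n} (G : Graph n) {m} → IsForest G → HasComponents G m →
                  ∑[ v < n ] degree G v + 2 * m ≡ 2 * n
forest-∑-degree {zero}  G {zero}  _      _                 = refl
forest-∑-degree {zero}  G {suc m} _      (_ , c-surj , _) with () ← proj₁ (c-surj zero)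
forest-∑-degree {suc n} G {m}     forest components        with v , deg≤1 ← forest⇒leaf G forest
  with degree G v in deg-v | deg≤1 | m | components
... | zero        | _      | zero   | (c , _) with () ← c v
... | zero        | _      | suc m′ | components′ =
  ∑-degree-∖-step G v (cong (_+ suc m′) deg-v)
    (forest-∑-degree (G ∖ v) (∖-forest G v forest)
      (∖-isolated-components G (degree≡0⇒isolated G deg-v) components′))
... | suc zero    | _      | m      | components′ =
  let p , vp , unique = degree≡1⇒leaf G deg-v
  in ∑-degree-∖-step G v (cong (_+ m) deg-v)
       (forest-∑-degree (G ∖ v) (∖-forest G v forest) (∖-leaf-components G vp unique components′))
... | suc (suc _) | s≤s () | _      | _

-- Sums over orbits of the Klein four-group

∑⁴ : ∀ {n} → (Fin n → Fin n → Fin n → Fin n → ℕ) → ℕ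
∑⁴ {n} f = ∑[ i < n ] ∑[ j < n ] ∑[ k < n ] ∑[ l < n ] f i j k l

∑⁴-cong : ∀ {n} {f g : Fin n → Fin n → Fin n → Fin n → ℕ} →
          (∀ i j k l → f i j k l ≡ g i j k l) → ∑⁴ f ≡ ∑⁴ g
∑⁴-cong f≗g = sum-cong-≗ λ i → sum-cong-≗ λ j → sum-cong-≗ λ k → sum-cong-≗ λ l → f≗g i j k l

∑⁴-distrib-+ : ∀ {n} (f g : Fin n → Fin n → Fin n → Fin n → ℕ) →
               ∑⁴ (λ i j k l → f i j k l + g i j k l) ≡ ∑⁴ f + ∑⁴ g
∑⁴-distrib-+ {n} f g =
  trans (sum-cong-≗ λ i →
          trans (sum-cong-≗ λ j →
                  trans (sum-cong-≗ λ k → ∑-distrib-+ (f i j k) (g i j k))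
                        (∑-distrib-+ (λ k → ∑[ l < n ] f i j k l) (λ k → ∑[ l < n ] g i j k l)))
                (∑-distrib-+ (λ j → ∑[ k < n ] ∑[ l < n ] f i j k l)
                             (λ j → ∑[ k < n ] ∑[ l < n ] g i j k l)))
        (∑-distrib-+ (λ i → ∑[ j < n ] ∑[ k < n ] ∑[ l < n ] f i j k l)
                     (λ i → ∑[ j < n ] ∑[ k < n ] ∑[ l < n ] g i j k l))

∑⁴-swap₁ : ∀ {n} (f : Fin n → Fin n → Fin n → Fin n → ℕ) → ∑⁴ (λ i j k l → f j i l k) ≡ ∑⁴ f
∑⁴-swap₁ f = trans (∑-comm (λ i j → ∑[ k < _ ] ∑[ l < _ ] f j i l k))
                   (sum-cong-≗ λ j → sum-cong-≗ λ i → ∑-comm (λ k l → f j i l k))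

∑⁴-swap₂ : ∀ {n} (f : Fin n → Fin n → Fin n → Fin n → ℕ) → ∑⁴ (λ i j k l → f k l i j) ≡ ∑⁴ f
∑⁴-swap₂ {n} f = begin
  (∑[ i < n ] ∑[ j < n ] ∑[ k < n ] ∑[ l < n ] f k l i j)
    ≡⟨ sum-cong-≗ (λ i → ∑-comm (λ j k → ∑[ l < n ] f k l i j)) ⟩
  (∑[ i < n ] ∑[ k < n ] ∑[ j < n ] ∑[ l < n ] f k l i j)
    ≡⟨ ∑-comm (λ i k → ∑[ j < n ] ∑[ l < n ] f k l i j) ⟩
  (∑[ k < n ] ∑[ i < n ] ∑[ j < n ] ∑[ l < n ] f k l i j)
    ≡⟨ sum-cong-≗ (λ k → sum-cong-≗ (λ i → ∑-comm (λ j l → f k l i j))) ⟩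
  (∑[ k < n ] ∑[ i < n ] ∑[ l < n ] ∑[ j < n ] f k l i j)
    ≡⟨ sum-cong-≗ (λ k → ∑-comm (λ i l → ∑[ j < n ] f k l i j)) ⟩
  (∑[ k < n ] ∑[ l < n ] ∑[ i < n ] ∑[ j < n ] f k l i j) ∎
  where open ≡.≡-Reasoning

orbit : ∀ {n} → (Fin n → Fin n → Fin n → Fin n → ℕ) → Fin n → Fin n → Fin n → Fin n → ℕ
orbit f i j k l = f i j k l + (f j i l k + (f k l i j + f l k j i))

∑⁴-orbit : ∀ {n} (f : Fin n → Fin n → Fin n → Fin n → ℕ) → ∑⁴ (orbit f) ≡ 4 * ∑⁴ f
∑⁴-orbit f = begin
  ∑⁴ (orbit f)
    ≡⟨ trans (∑⁴-distrib-+ f _) (cong (∑⁴ f +_) (trans (∑⁴-distrib-+ f₁ _) (cong (∑⁴ f₁ +_) (∑⁴-distrib-+ f₂ f₃)))) ⟩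
  ∑⁴ f + (∑⁴ f₁ + (∑⁴ f₂ + ∑⁴ f₃))
    ≡⟨ cong (λ x → ∑⁴ f + x) (cong₂ _+_ (∑⁴-swap₁ f) (cong₂ _+_ (∑⁴-swap₂ f) (trans (∑⁴-swap₂ f₁) (∑⁴-swap₁ f)))) ⟩
  ∑⁴ f + (∑⁴ f + (∑⁴ f + ∑⁴ f))
    ≡⟨ cong (λ x → ∑⁴ f + (∑⁴ f + (∑⁴ f + x))) (+-identityʳ (∑⁴ f)) ⟨
  4 * ∑⁴ f ∎
  where
  open ≡.≡-Reasoning
  f₁ f₂ f₃ : Fin _ → Fin _ → Fin _ → Fin _ → ℕ
  f₁ i j k l = f j i l k
  f₂ i j k l = f k l i j
  f₃ i j k l = f l k j i

[_<_] : ∀ {n} → Fin n → Fin n → ℕ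
[ a < b ] = toℕ𝔹 (does (a <? b))

least : ∀ {n} → Fin n → Fin n → Fin n → Fin n → ℕ
least a b c d = [ a < b ] * ([ a < c ] * [ a < d ])

least-yes : ∀ {n} {a b c d : Fin n} → a Fin.< b → a Fin.< c → a Fin.< d → least a b c d ≡ 1
least-yes {a = a} {b} {c} {d} a<b a<c a<d
  rewrite dec-true (a <? b) a<b | dec-true (a <? c) a<c | dec-true (a <? d) a<d = refl

least-no₁ : ∀ {n} (a b c d : Fin n) → b Fin.< a → least a b c d ≡ 0
least-no₁ a b c d b<a rewrite dec-false (a <? b) (<-asym b<a) = refl

least-no₂ : ∀ {n} (a b c d : Fin n) → c Fin.< a → least a b c d ≡ 0
least-no₂ a b c d c<a rewrite dec-false (a <? c) (<-asym c<a) = *-zeroʳ [ a < b ]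

least-no₃ : ∀ {n} (a b c d : Fin n) → d Fin.< a → least a b c d ≡ 0
least-no₃ a b c d d<a rewrite dec-false (a <? d) (<-asym d<a) =
  trans (cong ([ a < b ] *_) (*-zeroʳ [ a < c ])) (*-zeroʳ [ a < b ])

Least : ∀ {n} → Fin n → Fin n → Fin n → Fin n → Set
Least a b c d = a Fin.< b × a Fin.< c × a Fin.< d

≢⇒<⊎> : ∀ {n} {a b : Fin n} → a ≢ b → a Fin.< b ⊎ b Fin.< a
≢⇒<⊎> {a = a} {b} a≢b with <-cmp a b
... | tri< a<b _ _ = inj₁ a<b
... | tri≈ _ a≡b _ = ⊥-elim (a≢b a≡b)
... | tri> _ _ b<a = inj₂ b<a

minimum-of-four : ∀ {n} {i j k l : Fin n} → Unique (i ∷ j ∷ k ∷ l ∷ []) →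
                  Least i j k l ⊎ Least j i k l ⊎ Least k i j l ⊎ Least l i j k
minimum-of-four ((i≢j ∷ i≢k ∷ i≢l ∷ []) ∷ (j≢k ∷ j≢l ∷ []) ∷ (k≢l ∷ []) ∷ [] ∷ [])
  with ≢⇒<⊎> i≢j | ≢⇒<⊎> k≢l | ≢⇒<⊎> i≢k | ≢⇒<⊎> i≢l | ≢⇒<⊎> j≢k | ≢⇒<⊎> j≢l
... | inj₁ i<j | inj₁ k<l | inj₁ i<k | _        | _        | _        = inj₁ (i<j , i<k , <-trans i<k k<l)
... | inj₁ i<j | inj₁ k<l | inj₂ k<i | _        | _        | _        = inj₂ (inj₂ (inj₁ (k<i , <-trans k<i i<j , k<l)))
... | inj₁ i<j | inj₂ l<k | _        | inj₁ i<l | _        | _        = inj₁ (i<j , <-trans i<l l<k , i<l)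
... | inj₁ i<j | inj₂ l<k | _        | inj₂ l<i | _        | _        = inj₂ (inj₂ (inj₂ (l<i , <-trans l<i i<j , l<k)))
... | inj₂ j<i | inj₁ k<l | _        | _        | inj₁ j<k | _        = inj₂ (inj₁ (j<i , j<k , <-trans j<k k<l))
... | inj₂ j<i | inj₁ k<l | _        | _        | inj₂ k<j | _        = inj₂ (inj₂ (inj₁ (<-trans k<j j<i , k<j , k<l)))
... | inj₂ j<i | inj₂ l<k | _        | _        | _        | inj₁ j<l = inj₂ (inj₁ (j<i , <-trans j<l l<k , j<l))
... | inj₂ j<i | inj₂ l<k | _        | _        | _        | inj₂ l<j = inj₂ (inj₂ (inj₂ (<-trans l<j j<i , l<j , l<k)))

orbit-least≡1 : ∀ {n} {i j k l : Fin n} → Unique (i ∷ j ∷ k ∷ l ∷ []) → orbit least i j k l ≡ 1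
orbit-least≡1 {i = i} {j} {k} {l} distinct with minimum-of-four distinct
... | inj₁ (i<j , i<k , i<l) =
  cong₂ _+_ (least-yes i<j i<k i<l)
            (cong₂ _+_ (least-no₁ j i l k i<j) (cong₂ _+_ (least-no₂ k l i j i<k) (least-no₃ l k j i i<l)))
... | inj₂ (inj₁ (j<i , j<k , j<l)) =
  cong₂ _+_ (least-no₁ i j k l j<i)
            (cong₂ _+_ (least-yes j<i j<l j<k) (cong₂ _+_ (least-no₃ k l i j j<k) (least-no₂ l k j i j<l)))
... | inj₂ (inj₂ (inj₁ (k<i , k<j , k<l))) =
  cong₂ _+_ (least-no₂ i j k l k<i)
            (cong₂ _+_ (least-no₃ j i l k k<j) (cong₂ _+_ (least-yes k<l k<i k<j) (least-no₁ l k j i k<l)))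
... | inj₂ (inj₂ (inj₂ (l<i , l<j , l<k))) =
  cong₂ _+_ (least-no₃ i j k l l<i)
            (cong₂ _+_ (least-no₂ j i l k l<j) (cong₂ _+_ (least-no₁ k l i j l<k) (least-yes l<k l<j l<i)))

-- Of the four tuples in the orbit of a tuple of distinct indices, exactly one starts with the
-- least index; weighting f by this indicator makes ∑⁴ f the sum of four equal reindexed sums.
4∣∑⁴ : ∀ {n} (f : Fin n → Fin n → Fin n → Fin n → ℕ) →
       (∀ i j k l → f i j k l ≡ f j i l k) → (∀ i j k l → f i j k l ≡ f k l i j) →
       (∀ i j k l → 1 ≤ f i j k l → Unique (i ∷ j ∷ k ∷ l ∷ [])) →
       4 ∣ ∑⁴ f
4∣∑⁴ f f≡f₁ f≡f₂ distinct =
  subst (4 ∣_) (≡.sym (trans (∑⁴-cong weighted) (∑⁴-orbit f·least))) (m∣m*n (∑⁴ f·least))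
  where
  open ≡.≡-Reasoning
  f·least : Fin _ → Fin _ → Fin _ → Fin _ → ℕ
  f·least i j k l = f i j k l * least i j k l
  f≡f*orbit : ∀ i j k l → f i j k l ≡ f i j k l * orbit least i j k l
  f≡f*orbit i j k l with f i j k l in eq
  ... | zero  = refl
  ... | suc x = ≡.sym (trans (cong (suc x *_) (orbit-least≡1 (distinct i j k l positive))) (*-identityʳ (suc x)))
    where
    positive : 1 ≤ f i j k l
    positive = subst (1 ≤_) (≡.sym eq) (s≤s z≤n)
  distribute : ∀ w a b c d → w * (a + (b + (c + d))) ≡ w * a + (w * b + (w * c + w * d))
  distribute = solve-∀
  weighted : ∀ i j k l → f i j k l ≡ orbit f·least i j k l
  weighted i j k l = begin
    f i j k l
      ≡⟨ f≡f*orbit i j k l ⟩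
    f i j k l * orbit least i j k l
      ≡⟨ distribute (f i j k l) _ _ _ _ ⟩
    f i j k l * least i j k l + (f i j k l * least j i l k + (f i j k l * least k l i j + f i j k l * least l k j i))
      ≡⟨ cong (f·least i j k l +_)
              (cong₂ _+_ (cong (_* least j i l k) (f≡f₁ i j k l))
                         (cong₂ _+_ (cong (_* least k l i j) (f≡f₂ i j k l))
                                    (cong (_* least l k j i) (trans (f≡f₂ i j k l) (f≡f₁ k l i j))))) ⟩
    orbit f·least i j k l ∎

-- Products of adjacency matrices

m*n+1≡m+n : ∀ {m n} → 1 ≤ m → 1 ≤ n → (2 ≤ m → 2 ≤ n → ⊥) → m * n + 1 ≡ m + n
m*n+1≡m+n {suc zero}    {n}        _ _ _ = trans (cong (_+ 1) (+-identityʳ n)) (+-comm n 1)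
m*n+1≡m+n {suc (suc m)} {suc zero} _ _ _ = cong (_+ 1) (*-identityʳ (suc (suc m)))
m*n+1≡m+n {suc (suc m)} {suc (suc n)} _ _ not-both = ⊥-elim (not-both (s≤s (s≤s z≤n)) (s≤s (s≤s z≤n)))

IsProduct : ∀ {n} → Graph n → Graph n → Graph n → Set
IsProduct {n} G H K = ∀ i j → adjℕ G i j ≡ ∑[ k < n ] (adjℕ H i k * adjℕ K k j)

module Product {n} (G H K : Graph n) (G≡HK : IsProduct G H K) where

  path⇒adj : ∀ {i k j} → Adj H i k → Adj K k j → Adj G i j
  path⇒adj {i} {k} {j} hᵢₖ kₖⱼ = toℕ𝔹-positive (begin
    1                                    ≡⟨ cong₂ (λ x y → toℕ𝔹 x * toℕ𝔹 y) hᵢₖ kₖⱼ ⟨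
    adjℕ H i k * adjℕ K k j              ≤⟨ xᵢ≤sum (λ l → adjℕ H i l * adjℕ K l j) k ⟩
    ∑[ l < n ] (adjℕ H i l * adjℕ K l j)   ≡⟨ G≡HK i j ⟨
    adjℕ G i j                           ∎)
    where open ≤-Reasoning

  adj⇒path : ∀ {i j} → Adj G i j → ∃ λ k → Adj H i k × Adj K k j
  adj⇒path {i} {j} gᵢⱼ =
    let k , positive = ∃-positive-term (λ k → adjℕ H i k * adjℕ K k j)
                         (subst (1 ≤_) (G≡HK i j) (≤-reflexive (cong toℕ𝔹 (≡.sym gᵢⱼ))))
    in k , toℕ𝔹*toℕ𝔹-positive positive

  ∑-degree≡∑-degree*degree : ∑[ i < n ] degree G i ≡ ∑[ k < n ] (degree H k * degree K k)
  ∑-degree≡∑-degree*degree = begin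
    ∑[ i < n ] ∑[ j < n ] adjℕ G i j
      ≡⟨ sum-cong-≗ (λ i → sum-cong-≗ (G≡HK i)) ⟩
    ∑[ i < n ] ∑[ j < n ] ∑[ k < n ] (adjℕ H i k * adjℕ K k j)
      ≡⟨ sum-cong-≗ (λ i → ∑-comm (λ j k → adjℕ H i k * adjℕ K k j)) ⟩
    ∑[ i < n ] ∑[ k < n ] ∑[ j < n ] (adjℕ H i k * adjℕ K k j)
      ≡⟨ sum-cong-≗ (λ i → sum-cong-≗ (λ k → *-distribˡ-sum (adjℕ H i k) (adjℕ K k))) ⟨
    ∑[ i < n ] ∑[ k < n ] (adjℕ H i k * degree K k)
      ≡⟨ ∑-comm (λ i k → adjℕ H i k * degree K k) ⟩
    ∑[ k < n ] ∑[ i < n ] (adjℕ H i k * degree K k)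
      ≡⟨ sum-cong-≗ (λ k → *-distribʳ-sum (degree K k) (λ i → adjℕ H i k)) ⟨
    ∑[ k < n ] ((∑[ i < n ] adjℕ H i k) * degree K k)
      ≡⟨ sum-cong-≗ (λ k → cong (_* degree K k) (sum-cong-≗ (λ i → cong toℕ𝔹 (sym H i k)))) ⟩
    ∑[ k < n ] (degree H k * degree K k) ∎
    where open ≡.≡-Reasoning

  degreeᴴ-positive : NoIsolatedVertices G → ∀ k → 1 ≤ degree H k
  degreeᴴ-positive noIsolated k =
    let l , kl , _ = adj⇒path (proj₂ (noIsolated k)) in count-true (adj H k) kl

  degreeᴷ-positive : NoIsolatedVertices G → ∀ k → 1 ≤ degree K k
  degreeᴷ-positive noIsolated k =
    let l , _ , lk = adj⇒path (Adj-sym G (proj₂ (noIsolated k))) in count-true (adj K k) (Adj-sym K lk)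

  degrees-not-both-≥2 : IsForest G → ∀ k → 2 ≤ degree H k → 2 ≤ degree K k → ⊥
  degrees-not-both-≥2 forest k 2≤degᴴ 2≤degᴷ =
    let i , i′ , i≢i′ , ki , ki′ = 2≤count⇒two (adj H k) 2≤degᴴ
        j , j′ , j≢j′ , kj , kj′ = 2≤count⇒two (adj K k) 2≤degᴷ
        edge : ∀ {a b} → Adj H k a → Adj K k b → Adj G a b
        edge ka kb = path⇒adj (Adj-sym H ka) kb
    in forest (square⇒cycle G (edge ki kj) (Adj-sym G (edge ki′ kj)) (edge ki′ kj′) (Adj-sym G (edge ki kj′))
                              i≢i′ j≢j′)

  2∣∑-degree+n : NoIsolatedVertices G → IsForest G → 2 ∣ ∑[ i < n ] degree G i + n
  2∣∑-degree+n noIsolated forest =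
    subst (2 ∣_) (≡.sym ∑-degree+n≡∑degᴴ+∑degᴷ) (∣m∣n⇒∣m+n (2∣∑-degree H) (2∣∑-degree K))
    where
    open ≡.≡-Reasoning
    ∑-degree+n≡∑degᴴ+∑degᴷ : ∑[ i < n ] degree G i + n ≡ ∑[ k < n ] degree H k + ∑[ k < n ] degree K k
    ∑-degree+n≡∑degᴴ+∑degᴷ = begin
      ∑[ i < n ] degree G i + n
        ≡⟨ cong₂ _+_ ∑-degree≡∑-degree*degree (≡.sym (sum-replicate-1 n)) ⟩
      ∑[ k < n ] (degree H k * degree K k) + ∑[ k < n ] 1
        ≡⟨ ∑-distrib-+ (λ k → degree H k * degree K k) (λ _ → 1) ⟨
      ∑[ k < n ] (degree H k * degree K k + 1)
        ≡⟨ sum-cong-≗ (λ k → m*n+1≡m+n (degreeᴴ-positive noIsolated k) (degreeᴷ-positive noIsolated k)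
                                         (degrees-not-both-≥2 forest k)) ⟩
      ∑[ k < n ] (degree H k + degree K k)
        ≡⟨ ∑-distrib-+ (degree H) (degree K) ⟩
      ∑[ k < n ] degree H k + ∑[ k < n ] degree K k ∎

  hkSquare : Fin n → Fin n → Fin n → Fin n → ℕ
  hkSquare i j k l = (adjℕ H i k * adjℕ K k j) * (adjℕ H j l * adjℕ K l i)

  ∑-degree≡∑⁴-hkSquare : ∑[ i < n ] degree G i ≡ ∑⁴ hkSquare
  ∑-degree≡∑⁴-hkSquare = begin
    ∑[ i < n ] ∑[ j < n ] adjℕ G i j
      ≡⟨ sum-cong-≗ (λ i → sum-cong-≗ (λ j →
           trans (toℕ𝔹-idem (adj G i j)) (cong (adjℕ G i j *_) (cong toℕ𝔹 (sym G i j))))) ⟩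
    ∑[ i < n ] ∑[ j < n ] (adjℕ G i j * adjℕ G j i)
      ≡⟨ sum-cong-≗ (λ i → sum-cong-≗ (λ j → cong₂ _*_ (G≡HK i j) (G≡HK j i))) ⟩
    ∑[ i < n ] ∑[ j < n ] (∑[ k < n ] (adjℕ H i k * adjℕ K k j) * ∑[ l < n ] (adjℕ H j l * adjℕ K l i))
      ≡⟨ sum-cong-≗ (λ i → sum-cong-≗ (λ j →
           trans (*-distribʳ-sum (∑[ l < n ] (adjℕ H j l * adjℕ K l i)) (λ k → adjℕ H i k * adjℕ K k j))
                 (sum-cong-≗ (λ k → *-distribˡ-sum (adjℕ H i k * adjℕ K k j) (λ l → adjℕ H j l * adjℕ K l i))))) ⟩
    ∑⁴ hkSquare ∎
    where open ≡.≡-Reasoning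

  hkSquare-distinct : ∀ i j k l → 1 ≤ hkSquare i j k l → Unique (i ∷ j ∷ k ∷ l ∷ [])
  hkSquare-distinct i j k l positive with toℕ𝔹⁴-positive positive
  ... | ik , kj , jl , li = (i≢j ∷ Adj⇒≢ H ik ∷ ≢-sym (Adj⇒≢ K li) ∷ [])
                          ∷ (≢-sym (Adj⇒≢ K kj) ∷ Adj⇒≢ H jl ∷ [])
                          ∷ (k≢l ∷ [])
                          ∷ [] ∷ []
    where
    i≢j : i ≢ j
    i≢j refl = Adj⇒≢ G (path⇒adj ik kj) refl
    k≢l : k ≢ l
    k≢l refl = Adj⇒≢ G (path⇒adj ik li) refl

  4∣∑-degree : 4 ∣ ∑[ i < n ] degree G i
  4∣∑-degree = subst (4 ∣_) (≡.sym ∑-degree≡∑⁴-hkSquare)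
    (4∣∑⁴ hkSquare (λ i j k l → *-comm (adjℕ H i k * adjℕ K k j) _) hkSquare-rotate hkSquare-distinct)
    where
    regroup : ∀ a b c d → (a * b) * (c * d) ≡ (a * d) * (c * b)
    regroup = solve-∀
    hkSquare-rotate : ∀ i j k l → hkSquare i j k l ≡ hkSquare k l i j
    hkSquare-rotate i j k l =
      trans (regroup (adjℕ H i k) (adjℕ K k j) (adjℕ H j l) (adjℕ K l i))
            (cong₂ _*_ (cong₂ _*_ (cong toℕ𝔹 (sym H i k)) (cong toℕ𝔹 (sym K l i)))
                       (cong₂ _*_ (cong toℕ𝔹 (sym H j l)) (cong toℕ𝔹 (sym K k j))))

4∣s⇒2∣s+n⇒s+2m≡2n⇒2∣m : ∀ {s m n} → 4 ∣ s → 2 ∣ s + n → s + 2 * m ≡ 2 * n → 2 ∣ m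
4∣s⇒2∣s+n⇒s+2m≡2n⇒2∣m {s} {m} {n} 4∣s 2∣s+n s+2m≡2n = *-cancelˡ-∣ 2 (∣m+n∣m⇒∣n 4∣s+2m 4∣s)
  where
  2∣n : 2 ∣ n
  2∣n = ∣m+n∣m⇒∣n 2∣s+n (∣-trans (divides 2 refl) 4∣s)
  4∣s+2m : 4 ∣ s + 2 * m
  4∣s+2m = subst (4 ∣_) (≡.sym s+2m≡2n) (*-monoʳ-∣ 2 2∣n)

theorem7p3 : ∀ (n : ℕ) (G : Graph n) (m : ℕ) → IsForest G → NoIsolatedVertices G
           → HasComponents G m → m % 2 ≡ 1 → ¬ Factorizable G
theorem7p3 n G m forest noIsolated components m-odd (H , K , σ , τ , ρ , A≡BC) =
  0≢1+n (trans (≡.sym (n∣m⇒m%n≡0 m 2 2∣m)) m-odd)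
  where
  G′ H′ K′ : Graph n
  G′ = pullback (σ ⟨$⟩ʳ_) G
  H′ = pullback (τ ⟨$⟩ʳ_) H
  K′ = pullback (ρ ⟨$⟩ʳ_) K
  G′≡H′K′ : IsProduct G′ H′ K′
  G′≡H′K′ i j = trans (A≡BC i j) (Σᶠ≡sum n _)
  open Product G′ H′ K′ G′≡H′K′ using (4∣∑-degree; 2∣∑-degree+n)
  2∣∑-degree+n′ : 2 ∣ ∑[ v < n ] degree G′ v + n
  2∣∑-degree+n′ = 2∣∑-degree+n (permute-noIsolatedVertices G σ noIsolated)
                               (pullback-forest (σ ⟨$⟩ʳ_) G (Injection.injective (↔⇒↣ σ)) forest)
  ∑-degree+2m≡2n : ∑[ v < n ] degree G′ v + 2 * m ≡ 2 * n
  ∑-degree+2m≡2n = trans (cong (_+ 2 * m) (∑-degree-permute G σ)) (forest-∑-degree G forest components)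
  2∣m : 2 ∣ m
  2∣m = 4∣s⇒2∣s+n⇒s+2m≡2n⇒2∣m 4∣∑-degree 2∣∑-degree+n′ ∑-degree+2m≡2n
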